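{- Let $G$ be an undirected connected graph with exactly $k$ node equivalence classes. Then every graph in $\mathrm{Par}^*(G)$ has exactly $k$ node equivalence classes.
   Context: For a graph $G$ and vertex $w$, $N_G(w)$ is the neighborhood of $w$. Two adjacent vertices $u,v$ are neighbor-equivalent if $N_G(v)\setminus\{u\}=N_G(u)\setminus\{v\}$. For a vertex $u$, $[u]$ denotes the set consisting of $u$ and all vertices neighbor-equivalent to $u$; the distinct sets $[u]$ are the node equivalence classes of $G$. $\mathrm{Par}(G)$ is the set of graphs obtained from $G=(V,E)$ by adding a new vertex $u\notin V$ and the edges $\{\{u,v'\}: v'\in N_G(v)\cup\{v\}\}$ for some $v\in V$; $\mathrm{Par}^0(G)=\{G\}$, $\mathrm{Par}^k(G)=\bigcup_{H\in\mathrm{Par}^{k-1}(G)}\mathrm{Par}(H)$, and $\mathrm{Par}^*(G)=\bigcup_{k\ge0}\mathrm{Par}^k(G)$. -}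

module Defs where

open import Data.Nat using (ℕ; zero; suc)
open import Data.Fin using (Fin; zero; suc; _≟_)
open import Data.Bool using (Bool; true; false; _∨_)
open import Data.Product using (Σ; _×_; _,_)
open import Relation.Nullary using (¬_; does)
open import Relation.Binary.PropositionalEquality using (_≡_; refl)
open import Function.Bundles using (_⇔_)
open import Function.Definitions using (Surjective)

record Graph (n : ℕ) : Set where
  field
    adj    : Fin n → Fin n → Bool
    sym    : ∀ u v → adj u v ≡ adj v u
    irrefl : ∀ v → adj v v ≡ false
open Graph public

_∈N[_]_ : ∀ {n} → Fin n → Graph n → Fin n → Set
w ∈N[ G ] v = adj G v w ≡ true

NeighborEquiv : ∀ {n} → Graph n → Fin n → Fin n → Set
NeighborEquiv G u v =
  (adj G u v ≡ true) ×
  (∀ w → ((w ∈N[ G ] v) × ¬ (w ≡ u)) ⇔ ((w ∈N[ G ] u) × ¬ (w ≡ v)))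

_∈Class[_]_ : ∀ {n} → Fin n → Graph n → Fin n → Set
w ∈Class[ G ] u = (w ≡ u) Data.Sum.⊎ NeighborEquiv G u w
  where import Data.Sum

SameClass : ∀ {n} → Graph n → Fin n → Fin n → Set
SameClass G u v = ∀ w → (w ∈Class[ G ] u) ⇔ (w ∈Class[ G ] v)

-- G has exactly k node equivalence classes: the set {[u] : u ∈ V}
-- of distinct classes is in bijection with Fin k, i.e. there is a
-- surjection f : V → Fin k with f u ≡ f v iff [u] = [v].
HasNumClasses : ∀ {n} → Graph n → ℕ → Set
HasNumClasses {n} G k =
  Σ (Fin n → Fin k) λ f → Surjective _≡_ _≡_ f ×
    (∀ u v → (f u ≡ f v) ⇔ SameClass G u v)

data Reach {n} (G : Graph n) : Fin n → Fin n → Set where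
  here : ∀ {u} → Reach G u u
  step : ∀ {u w v} → adj G u w ≡ true → Reach G w v → Reach G u v

Connected : ∀ {n} → Graph n → Set
Connected {n} G = ∀ (u v : Fin n) → Reach G u v

-- Par: add a new vertex (index zero; old vertices shifted by suc)
-- adjacent to v and to every vertex of N_G(v).
parAdj : ∀ {n} → Graph n → Fin n → Fin (suc n) → Fin (suc n) → Bool
parAdj G v zero    zero    = false
parAdj G v zero    (suc w) = does (w ≟ v) ∨ adj G v w
parAdj G v (suc w) zero    = does (w ≟ v) ∨ adj G v w
parAdj G v (suc a) (suc b) = adj G a b

parSym : ∀ {n} (G : Graph n) v a b → parAdj G v a b ≡ parAdj G v b a
parSym G v zero    zero    = refl
parSym G v zero    (suc b) = refl
parSym G v (suc a) zero    = refl
parSym G v (suc a) (suc b) = sym G a b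

parIrrefl : ∀ {n} (G : Graph n) v a → parAdj G v a a ≡ false
parIrrefl G v zero    = refl
parIrrefl G v (suc a) = irrefl G a

par : ∀ {n} → Graph n → Fin n → Graph (suc n)
par G v = record { adj = parAdj G v ; sym = parSym G v ; irrefl = parIrrefl G v }

data ParStar {n} (G : Graph n) : ∀ {m} → Graph m → Set where
  base : ParStar G G
  grow : ∀ {m} {H : Graph m} → ParStar G H → (v : Fin m) → ParStar G (par H v)

-- Two vertices are in the same class exactly when they have the same closed
-- neighbourhood N[u] = N(u) ∪ {u}.  In par G v the new vertex is a copy of v
-- with N[new] = N[v] ∪ {new}: closed adjacency in par G v is closed adjacency in
-- G pulled back along the map sending the new vertex to v.  Hence two vertices
-- of par G v are closed twins iff their images are, so the class-counting map
-- of G composed with that map counts the classes of par G v, and induction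
-- along Par* finishes.
module Submission where

open import Defs
open import Data.Nat using (ℕ; suc)
open import Data.Fin using (Fin; zero; suc; _≟_)
open import Data.Fin.Properties using (suc-injective)
open import Data.Bool using (true; _∨_)
open import Data.Sum using (_⊎_; inj₁; inj₂)
open import Data.Sum.Function.Propositional using (_⊎-cong_)
open import Data.Product using (_×_; _,_; proj₁)
open import Data.Empty using (⊥-elim)
open import Relation.Nullary using (¬_; does; yes; no)
open import Relation.Binary.PropositionalEquality using (_≡_; refl; trans; cong)
  renaming (sym to ≡-sym)
open import Function using (_∘_; const)
open import Function.Bundles using (_⇔_; mk⇔; Equivalence)
open import Function.Definitions using (Surjective)
import Function.Properties.Equivalence as ⇔
open import Function.Consequences.Propositional using (strictlySurjective⇒surjective)
open import Function.Construct.Composition using (surjective)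

open Equivalence

⊎-dropˡ : ∀ {A B : Set} → ¬ A → (A ⊎ B) ⇔ B
⊎-dropˡ ¬a = mk⇔ (λ { (inj₁ a) → ⊥-elim (¬a a) ; (inj₂ b) → b }) inj₂

≟-∨-true : ∀ {n} (c v : Fin n) b → ((does (c ≟ v) ∨ b) ≡ true) ⇔ (c ≡ v ⊎ b ≡ true)
≟-∨-true c v b with c ≟ v
... | yes c≡v = mk⇔ (const (inj₁ c≡v)) (const refl)
... | no  c≢v = ⇔.sym (⊎-dropˡ c≢v)

_∈N⁺[_]_ : ∀ {n} → Fin n → Graph n → Fin n → Set
c ∈N⁺[ G ] u = c ≡ u ⊎ c ∈N[ G ] u

ClosedTwins : ∀ {n} → Graph n → Fin n → Fin n → Set
ClosedTwins G u w = ∀ c → c ∈N⁺[ G ] u ⇔ c ∈N⁺[ G ] w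

module _ {n} (G : Graph n) where

  closedTwins-sym : ∀ {u w} → ClosedTwins G u w → ClosedTwins G w u
  closedTwins-sym t c = ⇔.sym (t c)

  closedTwins-trans : ∀ {u v w} → ClosedTwins G u v → ClosedTwins G v w → ClosedTwins G u w
  closedTwins-trans s t c = ⇔.trans (s c) (t c)

  ∈N⁺-sym : ∀ {c u} → c ∈N⁺[ G ] u ⇔ u ∈N⁺[ G ] c
  ∈N⁺-sym = mk⇔ flip flip
    where
    flip : ∀ {x y} → x ∈N⁺[ G ] y → y ∈N⁺[ G ] x
    flip (inj₁ x≡y) = inj₁ (≡-sym x≡y)
    flip {x} {y} (inj₂ yx) = inj₂ (trans (Graph.sym G x y) yx)

  adj⇒≢ : ∀ {u c} → c ∈N[ G ] u → ¬ c ≡ u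
  adj⇒≢ {u} uc refl with trans (≡-sym uc) (irrefl G u)
  ... | ()

  closed⇒punctured : ∀ {u w c} → (c ∈N⁺[ G ] w → c ∈N⁺[ G ] u) →
    c ∈N[ G ] w × ¬ c ≡ u → c ∈N[ G ] u × ¬ c ≡ w
  closed⇒punctured w⊆u (wc , c≢u) with w⊆u (inj₂ wc)
  ... | inj₁ c≡u = ⊥-elim (c≢u c≡u)
  ... | inj₂ uc  = uc , adj⇒≢ wc

  punctured⇒closed : ∀ {u w} → w ∈N[ G ] u →
    (∀ c → c ∈N[ G ] u × ¬ c ≡ w → c ∈N[ G ] w × ¬ c ≡ u) →
    ∀ c → c ∈N⁺[ G ] u → c ∈N⁺[ G ] w
  punctured⇒closed {u} {w} uw u⊆w c (inj₁ refl) = inj₂ (trans (Graph.sym G w u) uw)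
  punctured⇒closed {u} {w} uw u⊆w c (inj₂ uc) with c ≟ w
  ... | yes c≡w = inj₁ c≡w
  ... | no  c≢w = inj₂ (proj₁ (u⊆w c (uc , c≢w)))

  ∈Class⇔closedTwins : ∀ u w → w ∈Class[ G ] u ⇔ ClosedTwins G u w
  ∈Class⇔closedTwins u w = mk⇔ class⇒twins twins⇒class
    where
    class⇒twins : w ∈Class[ G ] u → ClosedTwins G u w
    class⇒twins (inj₁ refl) c = ⇔.refl
    class⇒twins (inj₂ (uw , eq)) c = mk⇔
      (punctured⇒closed uw (λ c → from (eq c)) c)
      (punctured⇒closed (trans (Graph.sym G w u) uw) (λ c → to (eq c)) c)

    twins⇒class : ClosedTwins G u w → w ∈Class[ G ] u
    twins⇒class t with w ≟ u
    ... | yes w≡u = inj₁ w≡u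
    ... | no  w≢u = inj₂ (uw , λ c → mk⇔ (closed⇒punctured (from (t c)))
                                         (closed⇒punctured (to (t c))))
      where
      uw : w ∈N[ G ] u
      uw with from (t w) (inj₁ refl)
      ... | inj₁ w≡u = ⊥-elim (w≢u w≡u)
      ... | inj₂ uw  = uw

  sameClass⇔closedTwins : ∀ u v → SameClass G u v ⇔ ClosedTwins G u v
  sameClass⇔closedTwins u v = mk⇔ same⇒twins twins⇒same
    where
    same⇒twins : SameClass G u v → ClosedTwins G u v
    same⇒twins s = closedTwins-sym (to (∈Class⇔closedTwins v u) (to (s u) (inj₁ refl)))

    twins⇒same : ClosedTwins G u v → SameClass G u v
    twins⇒same t w = mk⇔
      (λ w∈[u] → from (∈Class⇔closedTwins v w)
        (closedTwins-trans (closedTwins-sym t) (to (∈Class⇔closedTwins u w) w∈[u])))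
      (λ w∈[v] → from (∈Class⇔closedTwins u w)
        (closedTwins-trans t (to (∈Class⇔closedTwins v w) w∈[v])))

parent : ∀ {n} → Fin n → Fin (suc n) → Fin n
parent v zero    = v
parent v (suc a) = a

parent-surjective : ∀ {n} (v : Fin n) → Surjective _≡_ _≡_ (parent v)
parent-surjective v = strictlySurjective⇒surjective (λ a → suc a , refl)

module _ {n} (G : Graph n) (v : Fin n) where

  ∈N⁺-par : ∀ x c → c ∈N⁺[ par G v ] x ⇔ parent v c ∈N⁺[ G ] parent v x
  ∈N⁺-par zero    zero    = mk⇔ (const (inj₁ refl)) (const (inj₁ refl))
  ∈N⁺-par zero    (suc c) = ⇔.trans (⊎-dropˡ λ ()) (≟-∨-true c v (adj G v c))
  ∈N⁺-par (suc a) zero    =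
    ⇔.trans (⊎-dropˡ λ ()) (⇔.trans (≟-∨-true a v (adj G v a)) (∈N⁺-sym G))
  ∈N⁺-par (suc a) (suc c) = mk⇔ suc-injective (cong suc) ⊎-cong ⇔.refl

  closedTwins-par : ∀ x y →
    ClosedTwins (par G v) x y ⇔ ClosedTwins G (parent v x) (parent v y)
  closedTwins-par x y = mk⇔
    (λ t c → ⇔.trans (⇔.sym (∈N⁺-par x (suc c))) (⇔.trans (t (suc c)) (∈N⁺-par y (suc c))))
    (λ t c → ⇔.trans (∈N⁺-par x c) (⇔.trans (t (parent v c)) (⇔.sym (∈N⁺-par y c))))

  hasNumClasses-par : ∀ {k} → HasNumClasses G k → HasNumClasses (par G v) k
  hasNumClasses-par (f , f-surjective , f-classes) =
    f ∘ parent v , surjective _≡_ _≡_ _≡_ (parent-surjective v) f-surjective , classes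
    where
    classes : ∀ x y → (f (parent v x) ≡ f (parent v y)) ⇔ SameClass (par G v) x y
    classes x y =
      ⇔.trans (f-classes (parent v x) (parent v y))
      (⇔.trans (sameClass⇔closedTwins G (parent v x) (parent v y))
      (⇔.trans (⇔.sym (closedTwins-par x y))
               (⇔.sym (sameClass⇔closedTwins (par G v) x y))))

theorem11 : ∀ {n} (G : Graph n) (k : ℕ) → Connected G → HasNumClasses G k →
    ∀ {m} (H : Graph m) → ParStar G H → HasNumClasses H k
theorem11 G k _ G-classes .G base = G-classes
theorem11 G k connected G-classes .(par H v) (grow {H = H} G⇝H v) =
  hasNumClasses-par H v (theorem11 G k connected G-classes H G⇝H)
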